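{- Let $k\geq3$ and $n\geq3$, and write $n=2^tm$ with $t\geq 0$ and $m$ odd. Let $\delta=1$ if $k$ is odd and $\delta=2$ if $k$ is even. Then the number of $n$-tuples (edges) of $H_k(n-1)$ that do not lie in a negasymmetric circuit of $\mathcal{C}_k(n-1)$ (and hence lie in a non-negasymmetric circuit of $\mathcal{C}_k(n-1)$) is at least \[ r_{k,n,kn/2} - n(|N_0(n,k)|+|N_2(n,k)|)-m(|N_1(n,k)|-\delta)-\delta, \] with equality if $n$ is prime.
   Context: Tuples are $k$-ary (entries in $\mathbb{Z}_k$), negation is modulo $k$, $\mathbf{u}^R$ is the reverse of $\mathbf{u}$; a tuple $\mathbf{u}$ is negasymmetric if $\mathbf{u}=-\mathbf{u}^R$. The pseudoweight of $a\in\mathbb{Z}_k$ is $a$ if $a\ne0$ and $k/2$ if $a=0$, and of a tuple the sum over its entries; $r_{k,n,s}$ is the number of $k$-ary $n$-tuples of pseudoweight $s$. $B_k(n-1)$ is the de Bruijn digraph with vertices the $k$-ary $(n-1)$-tuples and edges the $k$-ary $n$-tuples $(a_0,\dots,a_{n-1})$ from $(a_0,\dots,a_{n-2})$ to $(a_1,\dots,a_{n-1})$; $H_k(n-1)$ is its subgraph of edges of pseudoweight exactly $kn/2$. For an $n$-tuple $(a_0,\dots,a_{n-1})$, with $p$ the least positive $c$ such that $a_i=a_{(i+c)\bmod n}$ for all $i$, $[a_0,\dots,a_{n-1}]$ is the circuit whose edges are the $p$ cyclic shifts $(a_j,\dots,a_{j+n-1})$ (indices mod $n$), $0\le j<p$;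 $p$ is its period. $\mathcal{C}_k(n-1)$ is the set of such circuits arising from edges of $H_k(n-1)$. A circuit is negasymmetric if it contains edges $\mathbf a,\mathbf b$ (not necessarily distinct) with $\mathbf a=-\mathbf b^R$, otherwise non-negasymmetric. $N_i(n,k)$ is the set of negasymmetric circuits in $\mathcal{C}_k(n-1)$ containing exactly $i$ negasymmetric $n$-tuples among their edges. -}

module Defs where

open import Data.Nat using (ℕ; zero; suc; _+_; _*_; _≟_; _%_)
open import Data.Fin as F using (Fin; toℕ; opposite)
open import Data.Vec as V using (Vec; []; _∷_; _∷ʳ_)
open import Data.Vec.Properties using (≡-dec)
open import Data.List as L using (List; length; filter; deduplicate; upTo; concatMap; allFin)
open import Data.List.Relation.Unary.Any using (Any; any?)
open import Data.List.Relation.Unary.All using (All; all?)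
open import Data.List.Membership.Propositional using (_∈_)
open import Data.Product using (_×_; ∃; _,_)
open import Relation.Nullary using (¬_; Dec; ¬?)
open import Relation.Nullary.Decidable using (_×-dec_)
open import Relation.Binary.PropositionalEquality using (_≡_)
open import Relation.Binary.Definitions using (DecidableEquality)

Tuple : ℕ → ℕ → Set
Tuple k n = Vec (Fin k) n

_≟t_ : ∀ {k n} → DecidableEquality (Tuple k n)
_≟t_ = ≡-dec F._≟_

-- negation modulo k on Z_k = Fin k : -0 = 0, -(i+1) = k-(i+1)
negF : ∀ {k} → Fin k → Fin k
negF F.zero    = F.zero
negF (F.suc i) = F.suc (opposite i)

negT : ∀ {k n} → Tuple k n → Tuple k n
negT = V.map negF

Negasym : ∀ {k n} → Tuple k n → Set
Negasym u = u ≡ negT (V.reverse u)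

negasym? : ∀ {k n} (u : Tuple k n) → Dec (Negasym u)
negasym? u = u ≟t negT (V.reverse u)

-- TWICE the pseudoweight (pseudoweight of 0 is k/2, which may be a half-integer)
pw2 : ∀ {k} → Fin k → ℕ
pw2 {k} F.zero = k
pw2 (F.suc i)  = 2 * suc (toℕ i)

pw2T : ∀ {k n} → Tuple k n → ℕ
pw2T []       = 0
pw2T (a ∷ u)  = pw2 a + pw2T u

allTuples : ∀ k n → List (Tuple k n)
allTuples k zero    = [] L.∷ L.[]
allTuples k (suc n) = concatMap (λ a → L.map (a ∷_) (allTuples k n)) (allFin k)

-- r2 k n s = number of k-ary n-tuples whose pseudoweight is s/2
-- (so r_{k,n,kn/2} = r2 k n (k * n))
r2 : ℕ → ℕ → ℕ → ℕ
r2 k n s = length (filter (λ u → pw2T u ≟ s) (allTuples k n))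

-- edges of H_k(n-1): n-tuples of pseudoweight exactly kn/2
InH : ∀ {k n} → Tuple k n → Set
InH {k} {n} u = pw2T u ≡ k * n

inH? : ∀ {k n} (u : Tuple k n) → Dec (InH u)
inH? {k} {n} u = pw2T u ≟ k * n

Hedges : ∀ k n → List (Tuple k n)
Hedges k n = filter inH? (allTuples k n)

rot1 : ∀ {k n} → Tuple k n → Tuple k n
rot1 []      = []
rot1 (a ∷ u) = u ∷ʳ a

shift : ∀ {k n} → ℕ → Tuple k n → Tuple k n
shift zero    u = u
shift (suc j) u = rot1 (shift j u)

headOr : ℕ → List ℕ → ℕ
headOr d L.[]      = d
headOr d (x L.∷ _) = x

period : ∀ {k n} → Tuple k n → ℕ
period {k} {n} u = headOr n (filter (λ c → shift c u ≟t u) (L.map suc (upTo n)))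

-- a circuit, given by its list of edges: the p cyclic shifts, 0 ≤ j < p
Circuit : ℕ → ℕ → Set
Circuit k n = List (Tuple k n)

circuit : ∀ {k n} → Tuple k n → Circuit k n
circuit u = L.map (λ j → shift j u) (upTo (period u))

SameCircuit : ∀ {k n} → Circuit k n → Circuit k n → Set
SameCircuit c d = All (λ x → x ∈ d) c × All (λ x → x ∈ c) d

_∈?t_ : ∀ {k n} (x : Tuple k n) (c : Circuit k n) → Dec (x ∈ c)
x ∈?t c = any? (x ≟t_) c

sameCircuit? : ∀ {k n} (c d : Circuit k n) → Dec (SameCircuit c d)
sameCircuit? c d = all? (_∈?t d) c ×-dec all? (_∈?t c) d

-- C_k(n-1): the set of circuits [u] for edges u of H_k(n-1) (listed without repetition)
circuitsC : ∀ k n → List (Circuit k n)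
circuitsC k n = deduplicate sameCircuit? (L.map circuit (Hedges k n))

NegasymCircuit : ∀ {k n} → Circuit k n → Set
NegasymCircuit c = Any (λ a → Any (λ b → a ≡ negT (V.reverse b)) c) c

negasymCircuit? : ∀ {k n} (c : Circuit k n) → Dec (NegasymCircuit c)
negasymCircuit? c = any? (λ a → any? (λ b → a ≟t negT (V.reverse b)) c) c

numNegasymEdges : ∀ {k n} → Circuit k n → ℕ
numNegasymEdges c = length (filter negasym? c)

Nset : ℕ → (n k : ℕ) → List (Circuit k n)
Nset i n k = filter (λ c → negasymCircuit? c ×-dec (numNegasymEdges c ≟ i)) (circuitsC k n)

InNegasymCircuit : ∀ {k n} → Tuple k n → Set
InNegasymCircuit {k} {n} u = Any (λ c → NegasymCircuit c × u ∈ c) (circuitsC k n)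

inNegasymCircuit? : ∀ {k n} (u : Tuple k n) → Dec (InNegasymCircuit u)
inNegasymCircuit? {k} {n} u = any? (λ c → negasymCircuit? c ×-dec (u ∈?t c)) (circuitsC k n)

numEdgesNotInNegasym : ℕ → ℕ → ℕ
numEdgesNotInNegasym k n = length (filter (λ u → ¬? (inNegasymCircuit? u)) (Hedges k n))

δ : ℕ → ℕ
δ k with k % 2
... | zero = 2
... | suc _ = 1

{-# OPTIONS --safe #-}
module Submission where

-- The circuits of C_k(n-1) are the orbits of the edges of H_k(n-1) under rotation, so they
-- partition those edges, and the edges lying in negasymmetric circuits are counted by the sum
-- of the lengths of the circuits in N₀, N₁ and N₂.  If a is a negasymmetric edge of a circuit
-- of period p, its rotation by j is negasymmetric iff p ∣ 2j; so a circuit has at most two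
-- negasymmetric edges (a and its half-turn), and exactly one only if p is odd.  The length of
-- a circuit is its period, a divisor of n = 2ᵗm: at most n, and at most m when odd.
-- The circuits of length 1 are the loops (a,…,a) with a of pseudoweight k/2, i.e. a = 0 or
-- a = k/2; there are δ of them and each lies in N₁.  Hence the covered edges number at most
-- n(|N₀| + |N₂|) + m(|N₁| - δ) + δ, with equality when n is prime, since then every other
-- circuit has length n = m.

open import Defs

module _ where

  open import Data.Nat
    using (ℕ; zero; suc; _+_; _*_; _^_; _∸_; _%_; _/_; ⌊_/2⌋; _≟_; _≤_; _<_; z≤n; s≤s; NonZero; >-nonZero)
  open import Data.Nat.DivMod using (m≡m%n+[m/n]*n; m%n<n)
  open import Data.Nat.Coprimality using (Coprime; coprime-divisor)
  open import Data.Nat.Primality using (Prime; prime⇒irreducible; irreducible[2])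
  open import Data.Nat.Divisibility using (_∣_; _∣?_; divides; m%n≡0⇒n∣m; n∣m⇒m%n≡0; ∣⇒≤)
  open import Data.Nat.Properties
  open import Data.Nat.ListAction using (sum)
  open import Data.Fin using (Fin; zero; suc; toℕ; opposite; fromℕ<)
  open import Data.Fin.Properties using (toℕ-injective; toℕ-fromℕ<; opposite-prop)
  open import Data.Vec using (Vec; []; _∷_; _∷ʳ_; toList; reverse; replicate; head)
  open import Data.Vec.Properties
    using (∷-injective; ∷-injectiveˡ; ∷-injectiveʳ; ∷ʳ-injective; map-∷ʳ; map-replicate; reverse-∷; reverse-involutive;
           toList-∷ʳ; toList-injective; length-toList; cast-is-id)
  open import Data.List using (List; []; _∷_; _++_; [_]; length; map; filter; concat; upTo; allFin)
  open import Data.List.Properties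
    using (filter-accept; length-++; ++-assoc; ++-identityʳ; length-map; length-upTo; map-upTo)
  open import Data.List.Membership.Propositional using (_∈_; find; lose)
  open import Data.List.Membership.Propositional.Properties
    using (∈-filter⁺; ∈-filter⁻; ∈-map⁺; ∈-map⁻; ∈-upTo⁺; ∈-upTo⁻; ∈-concat⁺′; ∈-concat⁻′; ∈-concatMap⁺; ∈-allFin;
           ∈-deduplicate⁻)
  open import Data.List.Membership.Propositional.Properties.WithK using (unique∧set⇒bag)
  open import Data.List.Relation.Unary.Any as Any using (here; there)
  import Data.List.Relation.Unary.Any.Properties as Any
  open import Data.List.Relation.Unary.All as All using (All; []; _∷_)
  import Data.List.Relation.Unary.All.Properties as All
  open import Data.List.Relation.Unary.AllPairs using (AllPairs; []; _∷_)
  import Data.List.Relation.Unary.AllPairs as AllPairs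
  import Data.List.Relation.Unary.AllPairs.Properties as AllPairs
  open import Data.List.Relation.Unary.Unique.Propositional using (Unique)
  import Data.List.Relation.Unary.Unique.Propositional.Properties as Unique
  open import Data.List.Relation.Unary.Unique.DecSetoid.Properties using (deduplicate-!)
  open import Data.List.Relation.Binary.Disjoint.Propositional using (Disjoint)
  open import Data.List.Relation.Binary.BagAndSetEquality using (∼bag⇒↭)
  open import Data.List.Relation.Binary.Permutation.Propositional.Properties using (↭-length)
  open import Data.Product using (_×_; _,_; proj₁; proj₂; ∃; swap)
  open import Data.Sum using (_⊎_; inj₁; inj₂; [_,_]′)
  open import Data.Empty using (⊥; ⊥-elim)
  open import Function.Base using (_∘_; id; case_of_)
  open import Function.Bundles using (_⇔_; Equivalence; mk⇔)
  open import Level using (Level; 0ℓ)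
  open import Relation.Nullary using (¬_; yes; no)
  open import Relation.Nullary.Decidable using (_×-dec_; _⊎-dec_)
  open import Relation.Binary.Core using (Rel)
  open import Relation.Binary.Bundles using (DecSetoid)
  open import Relation.Binary.Definitions using (tri<; tri≈; tri>)
  open import Relation.Unary using (Pred; Decidable)
  open import Relation.Unary.Properties using (∁?)
  open import Relation.Binary.PropositionalEquality
    using (_≡_; _≢_; refl; sym; trans; cong; cong₂; subst; ≢-sym; module ≡-Reasoning)
  open import Algebra.Properties.CommutativeSemigroup +-commutativeSemigroup using (x∙yz≈y∙xz)

  private variable
    ℓ p q r : Level
    A : Set ℓ
    k n : ℕ

  -- Counting in lists

  module _ {P : Pred A p} (P? : Decidable P) where

    length-filter-∁ : ∀ xs → length (filter P? xs) + length (filter (∁? P?) xs) ≡ length xs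
    length-filter-∁ [] = refl
    length-filter-∁ (x ∷ xs) with P? x
    ... | yes _ = cong suc (length-filter-∁ xs)
    ... | no _  = trans (+-suc _ _) (cong suc (length-filter-∁ xs))

    sum-map-filter-∁ : ∀ (w : A → ℕ) xs →
      sum (map w (filter P? xs)) + sum (map w (filter (∁? P?) xs)) ≡ sum (map w xs)
    sum-map-filter-∁ w [] = refl
    sum-map-filter-∁ w (x ∷ xs) with P? x
    ... | yes _ = trans (+-assoc (w x) _ _) (cong (w x +_) (sum-map-filter-∁ w xs))
    ... | no _  = trans (x∙yz≈y∙xz (sum (map w (filter P? xs))) (w x) _)
                        (cong (w x +_) (sum-map-filter-∁ w xs))

  module _ {P : Pred A p} {Q : Pred A q} {R : Pred A r}
           (P? : Decidable P) (Q? : Decidable Q) (R? : Decidable R) where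

    sum-map-filter-⊎ : ∀ (w : A → ℕ) xs →
      (∀ {x} → x ∈ xs → R x ⇔ (P x ⊎ Q x)) → (∀ {x} → x ∈ xs → P x → ¬ Q x) →
      sum (map w (filter R? xs)) ≡ sum (map w (filter P? xs)) + sum (map w (filter Q? xs))
    sum-map-filter-⊎ w [] _ _ = refl
    sum-map-filter-⊎ w (x ∷ xs) R⇔P⊎Q P⇒¬Q
      with R? x | P? x | Q? x | sum-map-filter-⊎ w xs (R⇔P⊎Q ∘ there) (P⇒¬Q ∘ there)
    ... | yes _  | yes px | yes qx | _  = ⊥-elim (P⇒¬Q (here refl) px qx)
    ... | yes _  | yes _  | no _   | ih = trans (cong (w x +_) ih) (sym (+-assoc (w x) _ _))
    ... | yes _  | no _   | yes _  | ih = trans (cong (w x +_) ih) (x∙yz≈y∙xz (w x) (sum (map w (filter P? xs))) _)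
    ... | yes rx | no ¬px | no ¬qx | _  = ⊥-elim ([ ¬px , ¬qx ]′ (Equivalence.to (R⇔P⊎Q (here refl)) rx))
    ... | no ¬rx | yes px | _      | _  = ⊥-elim (¬rx (Equivalence.from (R⇔P⊎Q (here refl)) (inj₁ px)))
    ... | no ¬rx | no _   | yes qx | _  = ⊥-elim (¬rx (Equivalence.from (R⇔P⊎Q (here refl)) (inj₂ qx)))
    ... | no _   | no _   | no _   | ih = ih

  sum-map-≤ : ∀ (w : A → ℕ) {b} xs → All (λ x → w x ≤ b) xs → sum (map w xs) ≤ b * length xs
  sum-map-≤ w {b} [] [] = z≤n
  sum-map-≤ w {b} (x ∷ xs) (wx≤b ∷ ws≤b) =
    subst (w x + sum (map w xs) ≤_) (sym (*-suc b (length xs))) (+-mono-≤ wx≤b (sum-map-≤ w xs ws≤b))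

  sum-map-≡ : ∀ (w : A → ℕ) {b} xs → All (λ x → w x ≡ b) xs → sum (map w xs) ≡ b * length xs
  sum-map-≡ w {b} [] [] = sym (*-zeroʳ b)
  sum-map-≡ w {b} (x ∷ xs) (wx≡b ∷ ws≡b) =
    trans (cong₂ _+_ wx≡b (sum-map-≡ w xs ws≡b)) (sym (*-suc b (length xs)))

  length-concat : ∀ (xss : List (List A)) → length (concat xss) ≡ sum (map length xss)
  length-concat [] = refl
  length-concat (xs ∷ xss) = trans (length-++ xs) (cong (length xs +_) (length-concat xss))

  unique∧set⇒length≡ : ∀ {xs ys : List A} → Unique xs → Unique ys →
    (∀ {x} → x ∈ xs ⇔ x ∈ ys) → length xs ≡ length ys
  unique∧set⇒length≡ !xs !ys xs⇔ys = ↭-length (∼bag⇒↭ (unique∧set⇒bag !xs !ys xs⇔ys))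

  allPairs-mapWith∈ : ∀ {R S : Rel A r} {xs} → (∀ {x y} → x ∈ xs → y ∈ xs → R x y → S x y) →
    AllPairs R xs → AllPairs S xs
  allPairs-mapWith∈ f []           = []
  allPairs-mapWith∈ f (rx ∷ rxs) =
    All.tabulate (λ y∈ → f (here refl) (there y∈) (All.lookup rx y∈))
    ∷ allPairs-mapWith∈ (λ x∈ y∈ → f (there x∈) (there y∈)) rxs

  unique⇒length≤2 : ∀ {xs : List A} → Unique xs →
    (∀ {x y z} → x ∈ xs → y ∈ xs → z ∈ xs → x ≢ y → x ≢ z → y ≢ z → ⊥) → length xs ≤ 2
  unique⇒length≤2 {xs = []} _ _ = z≤n
  unique⇒length≤2 {xs = _ ∷ []} _ _ = s≤s z≤n
  unique⇒length≤2 {xs = _ ∷ _ ∷ []} _ _ = s≤s (s≤s z≤n)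
  unique⇒length≤2 {xs = _ ∷ _ ∷ _ ∷ _} ((x≢y ∷ x≢z ∷ _) ∷ (y≢z ∷ _) ∷ _) no-triple =
    ⊥-elim (no-triple (here refl) (there (here refl)) (there (there (here refl))) x≢y x≢z y≢z)

  distinct∈⇒2≤length : ∀ {xs : List A} {x y} → x ∈ xs → y ∈ xs → x ≢ y → 2 ≤ length xs
  distinct∈⇒2≤length {xs = _ ∷ []} (here refl) (here refl) x≢y = ⊥-elim (x≢y refl)
  distinct∈⇒2≤length {xs = _ ∷ _ ∷ _} _ _ _ = s≤s (s≤s z≤n)

  -- Rotations

  shift-+ : ∀ i j (u : Tuple k n) → shift (i + j) u ≡ shift i (shift j u)
  shift-+ zero    j u = refl
  shift-+ (suc i) j u = cong rot1 (shift-+ i j u)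

  shift-rot1 : ∀ i (u : Tuple k n) → shift i (rot1 u) ≡ rot1 (shift i u)
  shift-rot1 i u = trans (sym (shift-+ i 1 u)) (cong (λ j → shift j u) (+-comm i 1))

  rot1-injective : ∀ (u v : Tuple k n) → rot1 u ≡ rot1 v → u ≡ v
  rot1-injective []      []      _ = refl
  rot1-injective (a ∷ u) (b ∷ v) eq with ∷ʳ-injective u v eq
  ... | refl , refl = refl

  shift-injective : ∀ j (u v : Tuple k n) → shift j u ≡ shift j v → u ≡ v
  shift-injective zero    u v eq = eq
  shift-injective (suc j) u v eq = shift-injective j u v (rot1-injective _ _ eq)

  shift-*-fixed : ∀ {c} {u : Tuple k n} → shift c u ≡ u → ∀ q → shift (q * c) u ≡ u
  shift-*-fixed         fixed zero    = refl
  shift-*-fixed {c = c} {u} fixed (suc q) =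
    trans (shift-+ c (q * c) u) (trans (cong (shift c) (shift-*-fixed fixed q)) fixed)

  shift≡shift⇒fixed : ∀ {i j} (u : Tuple k n) → i ≤ j → shift i u ≡ shift j u → shift (j ∸ i) u ≡ u
  shift≡shift⇒fixed {i = i} {j} u i≤j eq = shift-injective i _ _ (begin
    shift i (shift (j ∸ i) u) ≡⟨ sym (shift-+ i (j ∸ i) u) ⟩
    shift (i + (j ∸ i)) u     ≡⟨ cong (λ c → shift c u) (m+[n∸m]≡n i≤j) ⟩
    shift j u                 ≡⟨ sym eq ⟩
    shift i u                 ∎)
    where open ≡-Reasoning

  pw2T-∷ʳ : ∀ (u : Tuple k n) a → pw2T (u ∷ʳ a) ≡ pw2T u + pw2 a
  pw2T-∷ʳ []      a = +-comm (pw2 a) 0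
  pw2T-∷ʳ (b ∷ u) a = trans (cong (pw2 b +_) (pw2T-∷ʳ u a)) (sym (+-assoc (pw2 b) _ _))

  pw2T-shift : ∀ j (u : Tuple k n) → pw2T (shift j u) ≡ pw2T u
  pw2T-shift zero    u       = refl
  pw2T-shift (suc j) u with shift j u | pw2T-shift j u
  ... | []    | eq = eq
  ... | a ∷ v | eq = trans (pw2T-∷ʳ v a) (trans (+-comm (pw2T v) (pw2 a)) eq)

  -- shift n u ≡ u is proved on the underlying lists, where rotating xs ++ ys by length xs
  -- involves no index arithmetic.
  module _ {A : Set ℓ} where

    rotate : List A → List A
    rotate []       = []
    rotate (a ∷ xs) = xs ++ [ a ]

    rotateBy : ℕ → List A → List A
    rotateBy zero    xs = xs
    rotateBy (suc j) xs = rotate (rotateBy j xs)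

    rotateBy-suc : ∀ j xs → rotateBy (suc j) xs ≡ rotateBy j (rotate xs)
    rotateBy-suc zero    xs = refl
    rotateBy-suc (suc j) xs = cong rotate (rotateBy-suc j xs)

    rotateBy-length-++ : ∀ xs ys → rotateBy (length xs) (xs ++ ys) ≡ ys ++ xs
    rotateBy-length-++ []       ys = sym (++-identityʳ ys)
    rotateBy-length-++ (x ∷ xs) ys = begin
      rotateBy (suc (length xs)) (x ∷ xs ++ ys)   ≡⟨ rotateBy-suc (length xs) _ ⟩
      rotateBy (length xs) ((xs ++ ys) ++ [ x ])  ≡⟨ cong (rotateBy (length xs)) (++-assoc xs ys _) ⟩
      rotateBy (length xs) (xs ++ ys ++ [ x ])    ≡⟨ rotateBy-length-++ xs (ys ++ [ x ]) ⟩
      (ys ++ [ x ]) ++ xs                         ≡⟨ ++-assoc ys _ xs ⟩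
      ys ++ x ∷ xs                                ∎
      where open ≡-Reasoning

  toList-shift : ∀ j (u : Tuple k n) → toList (shift j u) ≡ rotateBy j (toList u)
  toList-shift zero    u = refl
  toList-shift (suc j) u with shift j u | toList-shift j u
  ... | []    | eq = cong rotate eq
  ... | a ∷ v | eq = trans (toList-∷ʳ a v) (cong rotate eq)

  shift-length : ∀ (u : Tuple k n) → shift n u ≡ u
  shift-length {n = n} u = trans (sym (cast-is-id refl (shift n u))) (toList-injective refl _ _ (begin
    toList (shift n u)                                  ≡⟨ toList-shift n u ⟩
    rotateBy n (toList u)                               ≡⟨ cong₂ rotateBy (sym (length-toList u))
                                                                           (sym (++-identityʳ (toList u))) ⟩
    rotateBy (length (toList u)) (toList u ++ []) ≡⟨ rotateBy-length-++ (toList u) [] ⟩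
    toList u                                            ∎))
    where open ≡-Reasoning

  shift-inverse : ∀ c (u : Tuple k (suc n)) → shift (c * n) (shift c u) ≡ u
  shift-inverse {n = n} c u = begin
    shift (c * n) (shift c u) ≡⟨ sym (shift-+ (c * n) c u) ⟩
    shift (c * n + c) u       ≡⟨ cong (λ j → shift j u) (trans (+-comm (c * n) c) (sym (*-suc c n))) ⟩
    shift (c * suc n) u       ≡⟨ shift-*-fixed (shift-length u) c ⟩
    u                         ∎
    where open ≡-Reasoning

  -- Periods and circuits

  headOr-∈ : ∀ {d x} {xs : List ℕ} → x ∈ xs → headOr d xs ∈ xs
  headOr-∈ {xs = _ ∷ _} _ = here refl

  headOr-≤ : ∀ {d x} {xs : List ℕ} → AllPairs _<_ xs → x ∈ xs → headOr d xs ≤ x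
  headOr-≤ _           (here refl) = ≤-refl
  headOr-≤ (h<xs ∷ _) (there x∈xs) = <⇒≤ (All.lookup h<xs x∈xs)

  ∈-map-suc-upTo⁺ : ∀ {c m} → 0 < c → c ≤ m → c ∈ map suc (upTo m)
  ∈-map-suc-upTo⁺ {suc c} _ c<m = ∈-map⁺ suc (∈-upTo⁺ c<m)

  ∈-map-suc-upTo⁻ : ∀ {c m} → c ∈ map suc (upTo m) → 0 < c × c ≤ m
  ∈-map-suc-upTo⁻ c∈ with ∈-map⁻ suc c∈
  ... | c′ , c′∈ , refl = s≤s z≤n , ∈-upTo⁻ c′∈

  map-suc-upTo-sorted : ∀ m → AllPairs _<_ (map suc (upTo m))
  map-suc-upTo-sorted m = AllPairs.map⁺ (AllPairs.applyUpTo⁺₁ id m (λ i<j _ → s≤s i<j))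

  module _ (u : Tuple k (suc n)) where

    private
      fixes? : Decidable (λ c → shift c u ≡ u)
      fixes? c = shift c u ≟t u

      candidates : List ℕ
      candidates = map suc (upTo (suc n))

      fixers : List ℕ
      fixers = filter fixes? candidates

      ∈-fixers⁺ : ∀ {c} → 0 < c → c ≤ suc n → shift c u ≡ u → c ∈ fixers
      ∈-fixers⁺ 0<c c≤n fixed = ∈-filter⁺ fixes? (∈-map-suc-upTo⁺ 0<c c≤n) fixed

      period∈fixers : period u ∈ fixers
      period∈fixers = headOr-∈ {xs = fixers} (∈-fixers⁺ (s≤s z≤n) ≤-refl (shift-length u))

    shift-period : shift (period u) u ≡ u
    shift-period = proj₂ (∈-filter⁻ fixes? {xs = candidates} period∈fixers)

    0<period : 0 < period u
    0<period = proj₁ (∈-map-suc-upTo⁻ (proj₁ (∈-filter⁻ fixes? {xs = candidates} period∈fixers)))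

    period≤n : period u ≤ suc n
    period≤n = proj₂ (∈-map-suc-upTo⁻ (proj₁ (∈-filter⁻ fixes? {xs = candidates} period∈fixers)))

    period-minimal : ∀ {c} → 0 < c → c < period u → shift c u ≢ u
    period-minimal 0<c c<p fixed = <⇒≱ c<p
      (headOr-≤ {xs = fixers} (AllPairs.filter⁺ fixes? (map-suc-upTo-sorted (suc n)))
                (∈-fixers⁺ 0<c (<⇒≤ (<-≤-trans c<p period≤n)) fixed))

  module _ (u : Tuple k (suc n)) where

    private instance
      period-nonZero : NonZero (period u)
      period-nonZero = >-nonZero (0<period u)

    shift-%-period : ∀ c → shift c u ≡ shift (c % period u) u
    shift-%-period c = begin
      shift c u                                    ≡⟨ cong (λ j → shift j u) (m≡m%n+[m/n]*n c (period u)) ⟩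
      shift (c % period u + c / period u * period u) u ≡⟨ shift-+ (c % period u) (c / period u * period u) u ⟩
      shift (c % period u) (shift (c / period u * period u) u)
        ≡⟨ cong (shift (c % period u)) (shift-*-fixed (shift-period u) (c / period u)) ⟩
      shift (c % period u) u                       ∎
      where open ≡-Reasoning

    fixed⇒period∣ : ∀ {c} → shift c u ≡ u → period u ∣ c
    fixed⇒period∣ {c} fixed = m%n≡0⇒n∣m c (period u) c%p≡0
      where
      c%p≡0 : c % period u ≡ 0
      c%p≡0 with c % period u | m%n<n c (period u) | shift-%-period c
      ... | zero  | _   | _  = refl
      ... | suc r | r<p | eq = ⊥-elim (period-minimal u (s≤s z≤n) r<p (trans (sym eq) fixed))

    period∣n : period u ∣ suc n
    period∣n = fixed⇒period∣ (shift-length u)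

    shift-injective-<period : ∀ {i j} → i < period u → j < period u → shift i u ≡ shift j u → i ≡ j
    shift-injective-<period {i} {j} i<p j<p eq with <-cmp i j
    ... | tri≈ _ i≡j _ = i≡j
    ... | tri< i<j _ _ = ⊥-elim (period-minimal u (m<n⇒0<n∸m i<j) (≤-<-trans (m∸n≤m j i) j<p)
                                   (shift≡shift⇒fixed u (<⇒≤ i<j) eq))
    ... | tri> _ _ j<i = ⊥-elim (period-minimal u (m<n⇒0<n∸m j<i) (≤-<-trans (m∸n≤m i j) i<p)
                                   (shift≡shift⇒fixed u (<⇒≤ j<i) (sym eq)))

    ∈-circuit⁻ : ∀ {y} → y ∈ circuit u → ∃ λ j → j < period u × y ≡ shift j u
    ∈-circuit⁻ y∈ with ∈-map⁻ (λ j → shift j u) y∈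
    ... | j , j∈ , refl = j , ∈-upTo⁻ j∈ , refl

    shift∈circuit : ∀ c → shift c u ∈ circuit u
    shift∈circuit c = subst (_∈ circuit u) (sym (shift-%-period c))
      (∈-map⁺ (λ j → shift j u) (∈-upTo⁺ (m%n<n c (period u))))

    length-circuit : length (circuit u) ≡ period u
    length-circuit = trans (length-map (λ j → shift j u) (upTo (period u))) (length-upTo (period u))

    circuit-unique : Unique (circuit u)
    circuit-unique = subst Unique (sym (map-upTo (λ j → shift j u) (period u)))
      (Unique.applyUpTo⁺₁ (λ j → shift j u) (period u)
        (λ i<j j<p eq → <⇒≢ i<j (shift-injective-<period (<-trans i<j j<p) j<p eq)))

  shared-edge⇒⊆ : ∀ {u v x : Tuple k (suc n)} → x ∈ circuit u → x ∈ circuit v →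
    ∀ {y} → y ∈ circuit u → y ∈ circuit v
  shared-edge⇒⊆ {n = n} {u} {v} x∈u x∈v y∈u
    with ∈-circuit⁻ u x∈u | ∈-circuit⁻ v x∈v | ∈-circuit⁻ u y∈u
  ... | b , _ , x≡ | c , _ , refl | a , _ , refl =
    subst (_∈ circuit v) (begin
      shift (a + (b * n + c)) v                ≡⟨ shift-+ a (b * n + c) v ⟩
      shift a (shift (b * n + c) v)            ≡⟨ cong (shift a) (shift-+ (b * n) c v) ⟩
      shift a (shift (b * n) (shift c v))      ≡⟨ cong (shift a ∘ shift (b * n)) x≡ ⟩
      shift a (shift (b * n) (shift b u))      ≡⟨ cong (shift a) (shift-inverse b u) ⟩
      shift a u                                ∎)
      (shift∈circuit v (a + (b * n + c)))
    where open ≡-Reasoning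

  shared-edge⇒sameCircuit : ∀ {u v x : Tuple k (suc n)} → x ∈ circuit u → x ∈ circuit v →
    SameCircuit (circuit u) (circuit v)
  shared-edge⇒sameCircuit x∈u x∈v =
    All.tabulate (shared-edge⇒⊆ x∈u x∈v) , All.tabulate (shared-edge⇒⊆ x∈v x∈u)

  period-∈circuit : ∀ {u x : Tuple k (suc n)} → x ∈ circuit u → period x ≡ period u
  period-∈circuit {u = u} {x} x∈u = begin
    period x                ≡⟨ sym (length-circuit x) ⟩
    length (circuit x)      ≡⟨ unique∧set⇒length≡ (circuit-unique x) (circuit-unique u)
                                 (mk⇔ (shared-edge⇒⊆ (shift∈circuit x 0) x∈u)
                                      (shared-edge⇒⊆ x∈u (shift∈circuit x 0))) ⟩
    length (circuit u)      ≡⟨ length-circuit u ⟩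
    period u                ∎
    where open ≡-Reasoning

  -- The circuits of C_k(n-1)

  ∈-allTuples : ∀ (u : Tuple k n) → u ∈ allTuples k n
  ∈-allTuples []      = here refl
  ∈-allTuples {k} {suc n} (a ∷ u) =
    ∈-concatMap⁺ (λ b → map (b ∷_) (allTuples k n))
                 (Any.map (λ { refl → ∈-map⁺ (a ∷_) (∈-allTuples u) }) (∈-allFin a))

  allTuples-unique : ∀ k n → Unique (allTuples k n)
  allTuples-unique k zero    = [] ∷ []
  allTuples-unique k (suc n) = Unique.concat⁺
    (All.map⁺ (All.tabulate (λ _ → Unique.map⁺ ∷-injectiveʳ (allTuples-unique k n))))
    (AllPairs.map⁺ (AllPairs.tabulate⁺ {f = id} different-heads))
    where
    different-heads : ∀ {a b : Fin k} → a ≢ b →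
      Disjoint (map (a ∷_) (allTuples k n)) (map (b ∷_) (allTuples k n))
    different-heads a≢b (x∈a , x∈b) with ∈-map⁻ (_ ∷_) x∈a | ∈-map⁻ (_ ∷_) x∈b
    ... | _ , _ , refl | _ , _ , eq = a≢b (∷-injectiveˡ eq)

  Hedges-unique : Unique (Hedges k n)
  Hedges-unique {k} {n} = Unique.filter⁺ inH? (allTuples-unique k n)

  ∈-Hedges⁺ : ∀ {u : Tuple k n} → InH u → u ∈ Hedges k n
  ∈-Hedges⁺ {u = u} = ∈-filter⁺ inH? (∈-allTuples u)

  ∈-Hedges⁻ : ∀ {u : Tuple k n} → u ∈ Hedges k n → InH u
  ∈-Hedges⁻ {k} {n} u∈H = proj₂ (∈-filter⁻ inH? {xs = allTuples k n} u∈H)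

  circuit⊆Hedges : ∀ {u y : Tuple k (suc n)} → u ∈ Hedges k (suc n) → y ∈ circuit u → y ∈ Hedges k (suc n)
  circuit⊆Hedges {u = u} u∈H y∈u with ∈-circuit⁻ u y∈u
  ... | j , _ , refl = ∈-Hedges⁺ (trans (pw2T-shift j u) (∈-Hedges⁻ u∈H))

  sameCircuit-refl : ∀ {c : Circuit k n} → SameCircuit c c
  sameCircuit-refl = All.tabulate id , All.tabulate id

  sameCircuit-trans : ∀ {c d e : Circuit k n} → SameCircuit c d → SameCircuit d e → SameCircuit c e
  sameCircuit-trans (c⊆d , d⊆c) (d⊆e , e⊆d) = All.map (All.lookup d⊆e) c⊆d , All.map (All.lookup d⊆c) e⊆d

  sameCircuit-decSetoid : ℕ → ℕ → DecSetoid 0ℓ 0ℓ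
  sameCircuit-decSetoid k n = record
    { Carrier          = Circuit k n
    ; _≈_              = SameCircuit
    ; isDecEquivalence = record
      { isEquivalence = record { refl = sameCircuit-refl ; sym = swap ; trans = sameCircuit-trans }
      ; _≟_           = sameCircuit?
      }
    }

  circuitsC-distinct : AllPairs (λ c d → ¬ SameCircuit c d) (circuitsC k n)
  circuitsC-distinct {k} {n} = deduplicate-! (sameCircuit-decSetoid k n) (map circuit (Hedges k n))

  ∈-circuitsC⁻ : ∀ {c} → c ∈ circuitsC k n → ∃ λ u → u ∈ Hedges k n × c ≡ circuit u
  ∈-circuitsC⁻ {k} {n} c∈ = ∈-map⁻ circuit (∈-deduplicate⁻ sameCircuit? (map circuit (Hedges k n)) c∈)

  circuitsC-disjoint : AllPairs Disjoint (circuitsC k (suc n))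
  circuitsC-disjoint = allPairs-mapWith∈ disjoint circuitsC-distinct
    where
    disjoint : ∀ {c d} → c ∈ circuitsC _ _ → d ∈ circuitsC _ _ → ¬ SameCircuit c d → Disjoint c d
    disjoint c∈ d∈ c≉d (x∈c , x∈d) with ∈-circuitsC⁻ c∈ | ∈-circuitsC⁻ d∈
    ... | _ , _ , refl | _ , _ , refl = c≉d (shared-edge⇒sameCircuit x∈c x∈d)

  circuitsC-representative : ∀ {u : Tuple k n} → u ∈ Hedges k n →
    ∃ λ c → c ∈ circuitsC k n × SameCircuit c (circuit u)
  circuitsC-representative u∈H = find (Any.deduplicate⁺ sameCircuit? (λ d≈c c≈u → sameCircuit-trans d≈c c≈u)
    (Any.map (λ { refl → sameCircuit-refl }) (∈-map⁺ circuit u∈H)))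

  -- Negasymmetric edges of a circuit

  negRev : Tuple k n → Tuple k n
  negRev u = negT (reverse u)

  reverse-∷ʳ : ∀ {A : Set ℓ} {n} (u : Vec A n) x → reverse (u ∷ʳ x) ≡ x ∷ reverse u
  reverse-∷ʳ u x = begin
    reverse (u ∷ʳ x)                     ≡⟨ cong (λ w → reverse (w ∷ʳ x)) (sym (reverse-involutive u)) ⟩
    reverse (reverse (reverse u) ∷ʳ x)   ≡⟨ cong reverse (sym (reverse-∷ x (reverse u))) ⟩
    reverse (reverse (x ∷ reverse u))    ≡⟨ reverse-involutive (x ∷ reverse u) ⟩
    x ∷ reverse u                        ∎
    where open ≡-Reasoning

  rot1-negRev-rot1 : ∀ (v : Tuple k n) → rot1 (negRev (rot1 v)) ≡ negRev v
  rot1-negRev-rot1 []      = refl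
  rot1-negRev-rot1 (a ∷ u) = begin
    rot1 (negT (reverse (u ∷ʳ a)))   ≡⟨ cong (rot1 ∘ negT) (reverse-∷ʳ u a) ⟩
    negT (reverse u) ∷ʳ negF a       ≡⟨ sym (map-∷ʳ negF a (reverse u)) ⟩
    negT (reverse u ∷ʳ a)            ≡⟨ cong negT (sym (reverse-∷ a u)) ⟩
    negRev (a ∷ u)                   ∎
    where open ≡-Reasoning

  shift-negRev-shift : ∀ i (v : Tuple k n) → shift i (negRev (shift i v)) ≡ negRev v
  shift-negRev-shift zero    v = refl
  shift-negRev-shift (suc i) v = begin
    rot1 (shift i (negRev (rot1 (shift i v))))   ≡⟨ sym (shift-rot1 i _) ⟩
    shift i (rot1 (negRev (rot1 (shift i v))))   ≡⟨ cong (shift i) (rot1-negRev-rot1 (shift i v)) ⟩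
    shift i (negRev (shift i v))                 ≡⟨ shift-negRev-shift i v ⟩
    negRev v                                     ∎
    where open ≡-Reasoning

  negasym-shift⇒negRev≡ : ∀ i (v : Tuple k n) → Negasym (shift i v) → negRev v ≡ shift (i + i) v
  negasym-shift⇒negRev≡ i v negasym = begin
    negRev v                        ≡⟨ sym (shift-negRev-shift i v) ⟩
    shift i (negRev (shift i v))    ≡⟨ cong (shift i) (sym negasym) ⟩
    shift i (shift i v)             ≡⟨ sym (shift-+ i i v) ⟩
    shift (i + i) v                 ∎
    where open ≡-Reasoning

  ∣∧<+⇒≡0⊎≡ : ∀ {m d} → m ∣ d → d < m + m → d ≡ 0 ⊎ d ≡ m
  ∣∧<+⇒≡0⊎≡ (divides zero          d≡0)   _ = inj₁ d≡0
  ∣∧<+⇒≡0⊎≡ (divides (suc zero)    d≡m+0) _ = inj₂ (trans d≡m+0 (+-identityʳ _))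
  ∣∧<+⇒≡0⊎≡ {m} (divides (suc (suc q)) refl) d<m+m =
    ⊥-elim (<⇒≱ d<m+m (+-monoʳ-≤ m (m≤m+n m (q * m))))

  module _ {a : Tuple k (suc n)} (a-negasym : Negasym a) where

    negasym∈circuit⇒self⊎half-turn : ∀ {y} → y ∈ circuit a → Negasym y →
      y ≡ a ⊎ ∃ λ h → h + h ≡ period a × y ≡ shift h a
    negasym∈circuit⇒self⊎half-turn y∈a y-negasym with ∈-circuit⁻ a y∈a
    ... | j , j<p , refl with ∣∧<+⇒≡0⊎≡ (fixed⇒period∣ a (begin
          shift (j + j) a    ≡⟨ sym (negasym-shift⇒negRev≡ j a y-negasym) ⟩
          negRev a           ≡⟨ sym a-negasym ⟩
          a                  ∎)) (+-mono-< j<p j<p)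
      where open ≡-Reasoning
    ...   | inj₁ j+j≡0 = inj₁ (cong (λ c → shift c a) (m+n≡0⇒m≡0 j j+j≡0))
    ...   | inj₂ j+j≡p = inj₂ (j , j+j≡p , refl)

    half-turn-negasym : ∀ {h} → h + h ≡ period a → Negasym (shift h a)
    half-turn-negasym {h} h+h≡p = sym (shift-injective h _ _ (begin
      shift h (negRev (shift h a))   ≡⟨ shift-negRev-shift h a ⟩
      negRev a                       ≡⟨ sym a-negasym ⟩
      a                              ≡⟨ sym (shift-period a) ⟩
      shift (period a) a             ≡⟨ cong (λ c → shift c a) (sym h+h≡p) ⟩
      shift (h + h) a                ≡⟨ shift-+ h h a ⟩
      shift h (shift h a)            ∎))
      where open ≡-Reasoning

    half-turn-≢ : ∀ {h} → h + h ≡ period a → shift h a ≢ a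
    half-turn-≢ {zero}  0≡p _ = <⇒≢ (0<period a) 0≡p
    half-turn-≢ {suc h} h+h≡p = period-minimal a (s≤s z≤n) (subst (suc h <_) h+h≡p (m<m+n (suc h) (s≤s z≤n)))

  numNegasymEdges-circuit≤2 : ∀ (v : Tuple k (suc n)) → numNegasymEdges (circuit v) ≤ 2
  numNegasymEdges-circuit≤2 v = unique⇒length≤2 (Unique.filter⁺ negasym? (circuit-unique v)) no-three
    where
    negasym∈v : ∀ {x} → x ∈ filter negasym? (circuit v) → x ∈ circuit v × Negasym x
    negasym∈v = ∈-filter⁻ negasym? {xs = circuit v}

    no-three : ∀ {x y z} → x ∈ filter negasym? (circuit v) → y ∈ filter negasym? (circuit v) →
      z ∈ filter negasym? (circuit v) → x ≢ y → x ≢ z → y ≢ z → ⊥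
    no-three {x} x∈ y∈ z∈ x≢y x≢z y≢z with negasym∈v x∈ | negasym∈v y∈ | negasym∈v z∈
    ... | x∈v , x-neg | y∈v , y-neg | z∈v , z-neg
      with negasym∈circuit⇒self⊎half-turn x-neg (shared-edge⇒⊆ x∈v (shift∈circuit x 0) y∈v) y-neg
         | negasym∈circuit⇒self⊎half-turn x-neg (shared-edge⇒⊆ x∈v (shift∈circuit x 0) z∈v) z-neg
    ... | inj₁ y≡x | _        = x≢y (sym y≡x)
    ... | inj₂ _   | inj₁ z≡x = x≢z (sym z≡x)
    ... | inj₂ (h , h+h≡p , refl) | inj₂ (h′ , h′+h′≡p , refl) =
      y≢z (cong (λ c → shift c x) (begin
        h                 ≡⟨ n≡⌊n+n/2⌋ h ⟩
        ⌊ h + h /2⌋       ≡⟨ cong ⌊_/2⌋ (trans h+h≡p (sym h′+h′≡p)) ⟩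
        ⌊ h′ + h′ /2⌋     ≡⟨ sym (n≡⌊n+n/2⌋ h′) ⟩
        h′                ∎))
      where open ≡-Reasoning

  even-period⇒2≤numNegasymEdges : ∀ {v a : Tuple k (suc n)} → a ∈ circuit v → Negasym a → 2 ∣ period v →
    2 ≤ numNegasymEdges (circuit v)
  even-period⇒2≤numNegasymEdges {v = v} {a} a∈v a-negasym (divides h p≡h*2) =
    distinct∈⇒2≤length (∈-filter⁺ negasym? a∈v a-negasym)
                       (∈-filter⁺ negasym? half-turn∈v (half-turn-negasym a-negasym {h} h+h≡p))
                       (≢-sym (half-turn-≢ a-negasym {h} h+h≡p))
    where
    h+h≡p : h + h ≡ period a
    h+h≡p = begin
      h + h         ≡⟨ cong (h +_) (sym (+-identityʳ h)) ⟩
      2 * h         ≡⟨ *-comm 2 h ⟩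
      h * 2         ≡⟨ sym p≡h*2 ⟩
      period v      ≡⟨ sym (period-∈circuit a∈v) ⟩
      period a      ∎
      where open ≡-Reasoning

    half-turn∈v : shift h a ∈ circuit v
    half-turn∈v = shared-edge⇒⊆ (shift∈circuit a 0) a∈v (shift∈circuit a h)

  numNegasymEdges≡1⇒odd-period : ∀ (v : Tuple k (suc n)) → numNegasymEdges (circuit v) ≡ 1 → ¬ 2 ∣ period v
  numNegasymEdges≡1⇒odd-period v num≡1 2∣p with filter negasym? (circuit v) in eq
  ... | a ∷ [] with ∈-filter⁻ negasym? {xs = circuit v} (subst (a ∈_) (sym eq) (here refl))
  ...   | a∈v , a-negasym =
    <⇒≱ (s≤s (s≤s z≤n)) (subst (λ xs → 2 ≤ length xs) eq (even-period⇒2≤numNegasymEdges a∈v a-negasym 2∣p))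

  -- Loops

  replicate-∷ʳ : ∀ {A : Set ℓ} m (x : A) → replicate m x ∷ʳ x ≡ x ∷ replicate m x
  replicate-∷ʳ zero    x = refl
  replicate-∷ʳ (suc m) x = cong (x ∷_) (replicate-∷ʳ m x)

  ∷ʳ≡∷⇒replicate : ∀ {A : Set ℓ} {m} (w : Vec A m) x → w ∷ʳ x ≡ x ∷ w → w ≡ replicate m x
  ∷ʳ≡∷⇒replicate []      x _  = refl
  ∷ʳ≡∷⇒replicate (y ∷ w) x eq with ∷-injective eq
  ... | refl , eq′ = cong (y ∷_) (∷ʳ≡∷⇒replicate w x eq′)

  reverse-replicate : ∀ {A : Set ℓ} m (x : A) → reverse (replicate m x) ≡ replicate m x
  reverse-replicate zero    x = refl
  reverse-replicate (suc m) x =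
    trans (reverse-∷ x (replicate m x)) (trans (cong (_∷ʳ x) (reverse-replicate m x)) (replicate-∷ʳ m x))

  pw2T-replicate : ∀ m (x : Fin k) → pw2T (replicate m x) ≡ m * pw2 x
  pw2T-replicate zero    x = refl
  pw2T-replicate (suc m) x = cong (pw2 x +_) (pw2T-replicate m x)

  halfWeight⇒negF≡ : ∀ (x : Fin k) → pw2 x ≡ k → negF x ≡ x
  halfWeight⇒negF≡ zero            _         = refl
  halfWeight⇒negF≡ {suc k′} (suc i) pw2≡k = cong suc (toℕ-injective (begin
    toℕ (opposite i)                    ≡⟨ opposite-prop i ⟩
    k′ ∸ suc (toℕ i)                    ≡⟨ cong (_∸ suc (toℕ i)) (suc-injective (sym pw2≡k)) ⟩
    toℕ i + (suc (toℕ i) + 0) ∸ suc (toℕ i) ≡⟨ cong (λ j → toℕ i + j ∸ suc (toℕ i)) (+-identityʳ (suc (toℕ i))) ⟩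
    toℕ i + suc (toℕ i) ∸ suc (toℕ i)   ≡⟨ m+n∸n≡m (toℕ i) (suc (toℕ i)) ⟩
    toℕ i                               ∎))
    where open ≡-Reasoning

  halfWeight⇒replicate-negasym : ∀ m (x : Fin k) → pw2 x ≡ k → Negasym (replicate m x)
  halfWeight⇒replicate-negasym m x pw2≡k = sym (begin
    negT (reverse (replicate m x))   ≡⟨ cong negT (reverse-replicate m x) ⟩
    negT (replicate m x)             ≡⟨ map-replicate negF x m ⟩
    replicate m (negF x)             ≡⟨ cong (replicate m) (halfWeight⇒negF≡ x pw2≡k) ⟩
    replicate m x                    ∎)
    where open ≡-Reasoning

  rot1-replicate : ∀ m (x : Fin k) → rot1 (replicate m x) ≡ replicate m x
  rot1-replicate zero    x = refl
  rot1-replicate (suc m) x = replicate-∷ʳ m x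

  period-replicate : ∀ (x : Fin k) → period (replicate (suc n) x) ≡ 1
  period-replicate {n = n} x = ≤-antisym
    (≮⇒≥ (λ 1<p → period-minimal (replicate (suc n) x) (s≤s z≤n) 1<p (rot1-replicate (suc n) x)))
    (0<period (replicate (suc n) x))

  circuit-replicate : ∀ (x : Fin k) → circuit (replicate (suc n) x) ≡ [ replicate (suc n) x ]
  circuit-replicate {n = n} x =
    cong (λ p → map (λ j → shift j (replicate (suc n) x)) (upTo p)) (period-replicate {n = n} x)

  period≡1⇒replicate : ∀ (u : Tuple k (suc n)) → period u ≡ 1 → u ≡ replicate (suc n) (head u)
  period≡1⇒replicate (x ∷ w) p≡1 = cong (x ∷_) (∷ʳ≡∷⇒replicate w x
    (subst (λ c → shift c (x ∷ w) ≡ x ∷ w) p≡1 (shift-period (x ∷ w))))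

  replicate-InH⁺ : ∀ {x : Fin k} → pw2 x ≡ k → InH (replicate (suc n) x)
  replicate-InH⁺ {k} {n} {x} pw2≡k =
    trans (pw2T-replicate (suc n) x) (trans (cong (suc n *_) pw2≡k) (*-comm (suc n) k))

  replicate-InH⁻ : ∀ {x : Fin k} → InH (replicate (suc n) x) → pw2 x ≡ k
  replicate-InH⁻ {k} {n} {x} inH =
    *-cancelˡ-≡ (pw2 x) k (suc n) (trans (sym (pw2T-replicate (suc n) x)) (trans inH (*-comm k (suc n))))

  numNegasymEdges-replicate : ∀ m {x : Fin k} → pw2 x ≡ k → numNegasymEdges [ replicate m x ] ≡ 1
  numNegasymEdges-replicate m {x} pw2≡k =
    cong length (filter-accept negasym? (halfWeight⇒replicate-negasym m x pw2≡k))

  replicate∈circuitsC : ∀ {x : Fin k} → pw2 x ≡ k → [ replicate (suc n) x ] ∈ circuitsC k (suc n)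
  replicate∈circuitsC {n = n} {x} pw2≡k
    with circuitsC-representative (∈-Hedges⁺ {n = suc n} (replicate-InH⁺ pw2≡k))
  ... | d , d∈ , (d⊆ , _) with ∈-circuitsC⁻ d∈
  ... | v , _ , refl = subst (_∈ circuitsC _ _) (trans (cong circuit v≡x̄) (circuit-replicate x)) d∈
    where
    v≡x̄ : v ≡ replicate (suc n) x
    v≡x̄ with subst (v ∈_) (circuit-replicate x) (All.lookup d⊆ (shift∈circuit v 0))
    ... | here v≡x̄ = v≡x̄

  circuitsC-length≡1 : ∀ {c} → c ∈ circuitsC k (suc n) → length c ≡ 1 →
    ∃ λ x → pw2 x ≡ k × c ≡ [ replicate (suc n) x ]
  circuitsC-length≡1 {n = n} c∈ length≡1 with ∈-circuitsC⁻ c∈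
  ... | u , u∈H , refl = head u , replicate-InH⁻ (subst InH u≡x̄ (∈-Hedges⁻ u∈H)) ,
                         trans (cong circuit u≡x̄) (circuit-replicate (head u))
    where
    u≡x̄ : u ≡ replicate (suc n) (head u)
    u≡x̄ = period≡1⇒replicate u (trans (sym (length-circuit u)) length≡1)

  isHalfWeight? : Decidable (λ (x : Fin k) → pw2 x ≡ k)
  isHalfWeight? {k} x = pw2 x ≟ k

  halfWeightDigits : ∀ k → List (Fin k)
  halfWeightDigits k = filter isHalfWeight? (allFin k)

  halfWeightDigits-unique : Unique (halfWeightDigits k)
  halfWeightDigits-unique {k} = Unique.filter⁺ isHalfWeight? (Unique.allFin⁺ k)

  δ-even : ∀ {k} → 2 ∣ k → δ k ≡ 2
  δ-even {k} 2∣k with k % 2 | n∣m⇒m%n≡0 k 2 2∣k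
  ... | zero | _ = refl

  δ-odd : ∀ {k} → ¬ 2 ∣ k → δ k ≡ 1
  δ-odd {k} 2∤k with k % 2 | m%n≡0⇒n∣m k 2
  ... | zero  | k%2≡0⇒2∣k = ⊥-elim (2∤k (k%2≡0⇒2∣k refl))
  ... | suc _ | _         = refl

  length-halfWeightDigits : ∀ k → length (halfWeightDigits (suc k)) ≡ δ (suc k)
  length-halfWeightDigits k with 2 ∣? suc k
  ... | no 2∤k = trans (unique∧set⇒length≡ halfWeightDigits-unique ([] ∷ []) (mk⇔ to from)) (sym (δ-odd 2∤k))
    where
    to : ∀ {x} → x ∈ halfWeightDigits (suc k) → x ∈ [ zero ]
    to {zero}  _  = here refl
    to {suc i} x∈ = ⊥-elim (2∤k (divides (suc (toℕ i))
      (trans (sym (proj₂ (∈-filter⁻ isHalfWeight? {xs = allFin (suc k)} x∈))) (*-comm 2 _))))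
    from : ∀ {x} → x ∈ [ zero ] → x ∈ halfWeightDigits (suc k)
    from (here refl) = ∈-filter⁺ isHalfWeight? (∈-allFin zero) refl
  ... | yes (divides (suc h) 1+k≡[1+h]*2) =
    trans (unique∧set⇒length≡ halfWeightDigits-unique (((λ ()) ∷ []) ∷ [] ∷ []) (mk⇔ to from))
          (sym (δ-even (divides (suc h) 1+k≡[1+h]*2)))
    where
    h<k : h < k
    h<k = subst (h <_) (sym (suc-injective 1+k≡[1+h]*2)) (s≤s (m≤m*n h 2))
    half : Fin k
    half = fromℕ< h<k
    pw2-half : pw2 {suc k} (suc half) ≡ suc k
    pw2-half = trans (cong (λ j → 2 * suc j) (toℕ-fromℕ< h<k)) (trans (*-comm 2 (suc h)) (sym 1+k≡[1+h]*2))
    to : ∀ {x} → x ∈ halfWeightDigits (suc k) → x ∈ zero ∷ suc half ∷ []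
    to {zero}  _  = here refl
    to {suc i} x∈ = there (here (cong suc (toℕ-injective (suc-injective
      (*-cancelˡ-≡ _ _ 2 (trans (proj₂ (∈-filter⁻ isHalfWeight? {xs = allFin (suc k)} x∈)) (sym pw2-half)))))))
    from : ∀ {x} → x ∈ zero ∷ suc half ∷ [] → x ∈ halfWeightDigits (suc k)
    from (here refl)         = ∈-filter⁺ isHalfWeight? (∈-allFin zero) refl
    from (there (here refl)) = ∈-filter⁺ isHalfWeight? (∈-allFin (suc half)) pw2-half

  circuitsC-unique : Unique (circuitsC k n)
  circuitsC-unique = AllPairs.map (λ c≉d c≡d → c≉d (subst (SameCircuit _) c≡d sameCircuit-refl)) circuitsC-distinct

  inNset? : ∀ i → Decidable (λ (c : Circuit k n) → NegasymCircuit c × numNegasymEdges c ≡ i)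
  inNset? i c = negasymCircuit? c ×-dec (numNegasymEdges c ≟ i)

  ∈-Nset⁻ : ∀ {i c} → c ∈ Nset i n k → c ∈ circuitsC k n × NegasymCircuit c × numNegasymEdges c ≡ i
  ∈-Nset⁻ {n} {k} {i} c∈ = ∈-filter⁻ (inNset? i) {xs = circuitsC k n} c∈

  isLoop? : Decidable (λ (c : Circuit k n) → length c ≡ 1)
  isLoop? c = length c ≟ 1

  N1-loops N1-nonLoops : ∀ n k → List (Circuit k n)
  N1-loops    n k = filter isLoop? (Nset 1 n k)
  N1-nonLoops n k = filter (∁? isLoop?) (Nset 1 n k)

  length-N1-loops : ∀ k n → length (N1-loops (suc n) (suc k)) ≡ δ (suc k)
  length-N1-loops k n = begin
    length (N1-loops (suc n) (suc k))
      ≡⟨ unique∧set⇒length≡ (Unique.filter⁺ isLoop? (Unique.filter⁺ (inNset? 1) circuitsC-unique))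
                            (Unique.map⁺ loop-injective halfWeightDigits-unique) (mk⇔ to from) ⟩
    length (map loop (halfWeightDigits (suc k)))  ≡⟨ length-map loop (halfWeightDigits (suc k)) ⟩
    length (halfWeightDigits (suc k))             ≡⟨ length-halfWeightDigits k ⟩
    δ (suc k)                                     ∎
    where
    open ≡-Reasoning
    loop : Fin (suc k) → Circuit (suc k) (suc n)
    loop x = [ replicate (suc n) x ]

    loop-injective : ∀ {x y} → loop x ≡ loop y → x ≡ y
    loop-injective refl = refl

    to : ∀ {c} → c ∈ N1-loops (suc n) (suc k) → c ∈ map loop (halfWeightDigits (suc k))
    to c∈ with ∈-filter⁻ isLoop? {xs = Nset 1 (suc n) (suc k)} c∈
    ... | c∈N1 , length≡1 with circuitsC-length≡1 (proj₁ (∈-Nset⁻ c∈N1)) length≡1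
    ...   | x , pw2≡k , refl = ∈-map⁺ loop (∈-filter⁺ isHalfWeight? (∈-allFin x) pw2≡k)

    from : ∀ {c} → c ∈ map loop (halfWeightDigits (suc k)) → c ∈ N1-loops (suc n) (suc k)
    from c∈ with ∈-map⁻ loop c∈
    ... | x , x∈ , refl = ∈-filter⁺ isLoop? (∈-filter⁺ (inNset? 1) (replicate∈circuitsC pw2≡k)
            (here (here (halfWeight⇒replicate-negasym (suc n) x pw2≡k)) , numNegasymEdges-replicate (suc n) pw2≡k))
          refl
      where
      pw2≡k : pw2 x ≡ suc k
      pw2≡k = proj₂ (∈-filter⁻ isHalfWeight? {xs = allFin (suc k)} x∈)

  -- Lengths of circuits

  odd⇒nonZero : ∀ {m} → m % 2 ≡ 1 → NonZero m
  odd⇒nonZero {zero}  ()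
  odd⇒nonZero {suc m} _ = _

  odd⇒coprime-2 : ∀ {p} → ¬ 2 ∣ p → Coprime p 2
  odd⇒coprime-2 2∤p (d∣p , d∣2) with irreducible[2] d∣2
  ... | inj₁ d≡1 = d≡1
  ... | inj₂ refl = ⊥-elim (2∤p d∣p)

  odd∣2^t*m⇒∣m : ∀ {p} t {m} → ¬ 2 ∣ p → p ∣ 2 ^ t * m → p ∣ m
  odd∣2^t*m⇒∣m {p} zero    {m} _   p∣m = subst (p ∣_) (*-identityˡ m) p∣m
  odd∣2^t*m⇒∣m {p} (suc t) {m} 2∤p p∣2^[1+t]*m =
    odd∣2^t*m⇒∣m t 2∤p (coprime-divisor (odd⇒coprime-2 2∤p) (subst (p ∣_) (*-assoc 2 (2 ^ t) m) p∣2^[1+t]*m))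

  prime≡2^t*m⇒≡m : ∀ {p} t {m} → Prime p → 3 ≤ p → p ≡ 2 ^ t * m → p ≡ m
  prime≡2^t*m⇒≡m zero    {m} _     _   p≡m = trans p≡m (*-identityˡ m)
  prime≡2^t*m⇒≡m (suc t) {m} p-prime 3≤p p≡2^[1+t]*m
    with prime⇒irreducible p-prime (divides (2 ^ t * m)
           (trans p≡2^[1+t]*m (trans (*-assoc 2 (2 ^ t) m) (*-comm 2 (2 ^ t * m)))))
  ... | inj₂ refl = ⊥-elim (<⇒≱ 3≤p (s≤s (s≤s z≤n)))

  module _ {c : Circuit k (suc n)} (c∈ : c ∈ circuitsC k (suc n)) where

    circuitsC-length∣ : length c ∣ suc n
    circuitsC-length∣ with ∈-circuitsC⁻ c∈
    ... | u , _ , refl = subst (_∣ suc n) (sym (length-circuit u)) (period∣n u)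

    circuitsC-length≤ : length c ≤ suc n
    circuitsC-length≤ = ∣⇒≤ circuitsC-length∣

    circuitsC-numNegasymEdges≤2 : numNegasymEdges c ≤ 2
    circuitsC-numNegasymEdges≤2 with ∈-circuitsC⁻ c∈
    ... | u , _ , refl = numNegasymEdges-circuit≤2 u

    circuitsC-length≡1⇒numNegasymEdges≡1 : length c ≡ 1 → numNegasymEdges c ≡ 1
    circuitsC-length≡1⇒numNegasymEdges≡1 length≡1 with circuitsC-length≡1 c∈ length≡1
    ... | _ , pw2≡k , refl = numNegasymEdges-replicate (suc n) pw2≡k

    circuitsC-numNegasymEdges≡1⇒length≤ : ∀ t {m} .{{_ : NonZero m}} → suc n ≡ 2 ^ t * m →
      numNegasymEdges c ≡ 1 → length c ≤ m
    circuitsC-numNegasymEdges≡1⇒length≤ t n≡2^t*m num≡1 with ∈-circuitsC⁻ c∈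
    ... | u , _ , refl = subst (_≤ _) (sym (length-circuit u)) (∣⇒≤ (odd∣2^t*m⇒∣m t
      (numNegasymEdges≡1⇒odd-period u num≡1) (subst (period u ∣_) n≡2^t*m (period∣n u))))

    circuitsC-length-prime : Prime (suc n) → length c ≡ 1 ⊎ length c ≡ suc n
    circuitsC-length-prime n-prime = prime⇒irreducible n-prime circuitsC-length∣

  -- Counting the edges of negasymmetric circuits

  numEdges : List (Circuit k n) → ℕ
  numEdges cs = sum (map length cs)

  negasymCircuits : ∀ k n → List (Circuit k n)
  negasymCircuits k n = filter negasymCircuit? (circuitsC k n)

  length-filter-inNegasymCircuit : ∀ k n →
    length (filter inNegasymCircuit? (Hedges k (suc n))) ≡ numEdges (negasymCircuits k (suc n))
  length-filter-inNegasymCircuit k n =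
    trans (unique∧set⇒length≡ (Unique.filter⁺ inNegasymCircuit? Hedges-unique)
                              (Unique.concat⁺ circuits-unique
                                              (AllPairs.filter⁺ negasymCircuit? circuitsC-disjoint))
                              (mk⇔ to from))
          (length-concat (negasymCircuits k (suc n)))
    where
    to : ∀ {u} → u ∈ filter inNegasymCircuit? (Hedges k (suc n)) → u ∈ concat (negasymCircuits k (suc n))
    to u∈ with find (proj₂ (∈-filter⁻ inNegasymCircuit? {xs = Hedges k (suc n)} u∈))
    ... | c , c∈ , c-negasym , u∈c = ∈-concat⁺′ u∈c (∈-filter⁺ negasymCircuit? c∈ c-negasym)

    from : ∀ {u} → u ∈ concat (negasymCircuits k (suc n)) → u ∈ filter inNegasymCircuit? (Hedges k (suc n))
    from u∈ with ∈-concat⁻′ (negasymCircuits k (suc n)) u∈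
    ... | c , u∈c , c∈NCs with ∈-filter⁻ negasymCircuit? {xs = circuitsC k (suc n)} c∈NCs
    ...   | c∈ , c-negasym with ∈-circuitsC⁻ c∈
    ...     | v , v∈H , refl = ∈-filter⁺ inNegasymCircuit? (circuit⊆Hedges v∈H u∈c) (lose c∈ (c-negasym , u∈c))

    circuits-unique : All Unique (negasymCircuits k (suc n))
    circuits-unique = All.tabulate λ c∈NCs →
      case ∈-circuitsC⁻ (proj₁ (∈-filter⁻ negasymCircuit? {xs = circuitsC k (suc n)} c∈NCs)) of λ where
        (v , _ , refl) → circuit-unique v

  numEdgesNotInNegasym+numEdges-negasymCircuits : ∀ k n →
    numEdgesNotInNegasym k (suc n) + numEdges (negasymCircuits k (suc n)) ≡ length (Hedges k (suc n))
  numEdgesNotInNegasym+numEdges-negasymCircuits k n = begin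
    numEdgesNotInNegasym k (suc n) + numEdges (negasymCircuits k (suc n))
      ≡⟨ +-comm (numEdgesNotInNegasym k (suc n)) _ ⟩
    numEdges (negasymCircuits k (suc n)) + numEdgesNotInNegasym k (suc n)
      ≡⟨ cong (_+ numEdgesNotInNegasym k (suc n)) (sym (length-filter-inNegasymCircuit k n)) ⟩
    length (filter inNegasymCircuit? (Hedges k (suc n))) + numEdgesNotInNegasym k (suc n)
      ≡⟨ length-filter-∁ inNegasymCircuit? (Hedges k (suc n)) ⟩
    length (Hedges k (suc n))
      ∎
    where open ≡-Reasoning

  numEdges-negasymCircuits-Nset : ∀ k n → numEdges (negasymCircuits k (suc n)) ≡
    numEdges (Nset 0 (suc n) k) + (numEdges (Nset 1 (suc n) k) + numEdges (Nset 2 (suc n) k))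
  numEdges-negasymCircuits-Nset k n = trans
    (sum-map-filter-⊎ (inNset? 0) inNset₁₂? negasymCircuit? length (circuitsC k (suc n))
      (λ c∈ → mk⇔ (classify c∈) [ proj₁ , [ proj₁ , proj₁ ]′ ]′)
      (λ { _ (_ , ≡0) (inj₁ (_ , ≡1)) → 0≢1+n (trans (sym ≡0) ≡1)
         ; _ (_ , ≡0) (inj₂ (_ , ≡2)) → 0≢1+n (trans (sym ≡0) ≡2) }))
    (cong (numEdges (Nset 0 (suc n) k) +_)
      (sum-map-filter-⊎ (inNset? 1) (inNset? 2) inNset₁₂? length (circuitsC k (suc n))
        (λ _ → mk⇔ id id) (λ _ (_ , ≡1) (_ , ≡2) → 0≢1+n (suc-injective (trans (sym ≡1) ≡2)))))
    where
    inNset₁₂? : Decidable (λ (c : Circuit k (suc n)) →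
      (NegasymCircuit c × numNegasymEdges c ≡ 1) ⊎ (NegasymCircuit c × numNegasymEdges c ≡ 2))
    inNset₁₂? c = inNset? 1 c ⊎-dec inNset? 2 c

    classify : ∀ {c} → c ∈ circuitsC k (suc n) → NegasymCircuit c →
      (NegasymCircuit c × numNegasymEdges c ≡ 0) ⊎
      ((NegasymCircuit c × numNegasymEdges c ≡ 1) ⊎ (NegasymCircuit c × numNegasymEdges c ≡ 2))
    classify {c} c∈ c-negasym with numNegasymEdges c | circuitsC-numNegasymEdges≤2 c∈
    ... | 0 | _ = inj₁ (c-negasym , refl)
    ... | 1 | _ = inj₂ (inj₁ (c-negasym , refl))
    ... | 2 | _ = inj₂ (inj₂ (c-negasym , refl))
    ... | suc (suc (suc _)) | s≤s (s≤s ())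

  numEdges-N1 : ∀ k n →
    numEdges (Nset 1 (suc n) (suc k)) ≡ δ (suc k) + numEdges (N1-nonLoops (suc n) (suc k))
  numEdges-N1 k n = begin
    numEdges (Nset 1 (suc n) (suc k))
      ≡⟨ sym (sum-map-filter-∁ isLoop? length (Nset 1 (suc n) (suc k))) ⟩
    numEdges (N1-loops (suc n) (suc k)) + numEdges (N1-nonLoops (suc n) (suc k))
      ≡⟨ cong (_+ numEdges (N1-nonLoops (suc n) (suc k))) loops-edges ⟩
    δ (suc k) + numEdges (N1-nonLoops (suc n) (suc k))
      ∎
    where
    open ≡-Reasoning
    loops-edges : numEdges (N1-loops (suc n) (suc k)) ≡ δ (suc k)
    loops-edges = begin
      numEdges (N1-loops (suc n) (suc k))
        ≡⟨ sum-map-≡ length (N1-loops (suc n) (suc k)) (All.all-filter isLoop? (Nset 1 (suc n) (suc k))) ⟩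
      1 * length (N1-loops (suc n) (suc k))
        ≡⟨ *-identityˡ (length (N1-loops (suc n) (suc k))) ⟩
      length (N1-loops (suc n) (suc k))
        ≡⟨ length-N1-loops k n ⟩
      δ (suc k)
        ∎

  length-N1 : ∀ k n → length (Nset 1 (suc n) (suc k)) ≡ δ (suc k) + length (N1-nonLoops (suc n) (suc k))
  length-N1 k n = begin
    length (Nset 1 (suc n) (suc k))
      ≡⟨ sym (length-filter-∁ isLoop? (Nset 1 (suc n) (suc k))) ⟩
    length (N1-loops (suc n) (suc k)) + length (N1-nonLoops (suc n) (suc k))
      ≡⟨ cong (_+ length (N1-nonLoops (suc n) (suc k))) (length-N1-loops k n) ⟩
    δ (suc k) + length (N1-nonLoops (suc n) (suc k))
      ∎
    where open ≡-Reasoning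

  ∈-N1-nonLoops⁻ : ∀ {c} → c ∈ N1-nonLoops n k → c ∈ circuitsC k n × numNegasymEdges c ≡ 1 × length c ≢ 1
  ∈-N1-nonLoops⁻ {n} {k} c∈ with ∈-filter⁻ (∁? isLoop?) {xs = Nset 1 n k} c∈
  ... | c∈N1 , ¬loop with ∈-Nset⁻ c∈N1
  ...   | c∈CC , _ , num≡1 = c∈CC , num≡1 , ¬loop

  Nset-length≤ : ∀ i → All (λ c → length c ≤ suc n) (Nset i (suc n) k)
  Nset-length≤ i = All.tabulate (λ c∈ → circuitsC-length≤ (proj₁ (∈-Nset⁻ c∈)))

  N1-nonLoops-length≤ : ∀ t {m} .{{_ : NonZero m}} → suc n ≡ 2 ^ t * m →
    All (λ c → length c ≤ m) (N1-nonLoops (suc n) k)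
  N1-nonLoops-length≤ t n≡2^t*m = All.tabulate λ c∈ → case ∈-N1-nonLoops⁻ c∈ of λ where
    (c∈CC , num≡1 , _) → circuitsC-numNegasymEdges≡1⇒length≤ c∈CC t n≡2^t*m num≡1

  module _ (n-prime : Prime (suc n)) where

    Nset-length-prime : ∀ {i} → i ≢ 1 → All (λ c → length c ≡ suc n) (Nset i (suc n) k)
    Nset-length-prime i≢1 = All.tabulate λ c∈ → case ∈-Nset⁻ c∈ of λ where
      (c∈CC , _ , refl) → case circuitsC-length-prime c∈CC n-prime of λ where
        (inj₁ length≡1) → ⊥-elim (i≢1 (circuitsC-length≡1⇒numNegasymEdges≡1 c∈CC length≡1))
        (inj₂ length≡n) → length≡n

    N1-nonLoops-length-prime : All (λ c → length c ≡ suc n) (N1-nonLoops (suc n) k)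
    N1-nonLoops-length-prime = All.tabulate λ c∈ → case ∈-N1-nonLoops⁻ c∈ of λ where
      (c∈CC , _ , ¬loop) → case circuitsC-length-prime c∈CC n-prime of λ where
        (inj₁ length≡1) → ⊥-elim (¬loop length≡1)
        (inj₂ length≡n) → length≡n

  numEdges-negasymCircuits : ∀ k n → numEdges (negasymCircuits (suc k) (suc n)) ≡
    numEdges (Nset 0 (suc n) (suc k))
    + ((δ (suc k) + numEdges (N1-nonLoops (suc n) (suc k))) + numEdges (Nset 2 (suc n) (suc k)))
  numEdges-negasymCircuits k n = trans (numEdges-negasymCircuits-Nset (suc k) n)
    (cong (λ e₁ → numEdges (Nset 0 (suc n) (suc k)) + (e₁ + numEdges (Nset 2 (suc n) (suc k)))) (numEdges-N1 k n))

  numEdges-negasymCircuits≤ : ∀ k n t {m} .{{_ : NonZero m}} → suc n ≡ 2 ^ t * m →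
    numEdges (negasymCircuits (suc k) (suc n)) ≤
    suc n * length (Nset 0 (suc n) (suc k))
    + ((δ (suc k) + m * length (N1-nonLoops (suc n) (suc k))) + suc n * length (Nset 2 (suc n) (suc k)))
  numEdges-negasymCircuits≤ k n t n≡2^t*m = ≤-trans (≤-reflexive (numEdges-negasymCircuits k n))
    (+-mono-≤ (sum-map-≤ length (Nset 0 (suc n) (suc k)) (Nset-length≤ 0))
    (+-mono-≤ (+-monoʳ-≤ (δ (suc k))
                (sum-map-≤ length (N1-nonLoops (suc n) (suc k)) (N1-nonLoops-length≤ t n≡2^t*m)))
              (sum-map-≤ length (Nset 2 (suc n) (suc k)) (Nset-length≤ 2))))

  numEdges-negasymCircuits-prime : ∀ k n t {m} → 2 ≤ n → suc n ≡ 2 ^ t * m → Prime (suc n) →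
    numEdges (negasymCircuits (suc k) (suc n)) ≡
    suc n * length (Nset 0 (suc n) (suc k))
    + ((δ (suc k) + m * length (N1-nonLoops (suc n) (suc k))) + suc n * length (Nset 2 (suc n) (suc k)))
  numEdges-negasymCircuits-prime k n t 2≤n n≡2^t*m n-prime
    rewrite sym (prime≡2^t*m⇒≡m t n-prime (s≤s 2≤n) n≡2^t*m) =
    trans (numEdges-negasymCircuits k n)
      (cong₂ _+_ (sum-map-≡ length (Nset 0 (suc n) (suc k)) (Nset-length-prime n-prime (λ ())))
      (cong₂ _+_ (cong (δ (suc k) +_)
                   (sum-map-≡ length (N1-nonLoops (suc n) (suc k)) (N1-nonLoops-length-prime n-prime)))
                 (sum-map-≡ length (Nset 2 (suc n) (suc k)) (Nset-length-prime n-prime (λ ())))))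


-- The bound in ℤ

module _ where

  open import Data.Nat using (ℕ; _+_; _*_; _≤_)
  open import Data.Nat.Properties using (+-monoʳ-≤; m≤n+m; m+n∸n≡m)
  open import Data.Integer using (ℤ; +_; _-_; _⊖_)
  import Data.Integer as ℤ
  import Data.Integer.Properties as ℤ
  open import Data.Integer.Solver using (module +-*-Solver)
  open +-*-Solver using (solve; _:+_; _:*_; _:-_; _:=_)
  open import Relation.Binary.PropositionalEquality using (_≡_; refl; sym; trans; cong; cong₂; module ≡-Reasoning)

  lowerBound : (r n a₀ a₁ a₂ m d : ℕ) → ℤ
  lowerBound r n a₀ a₁ a₂ m d = + r - (+ n) ℤ.* ((+ a₀) ℤ.+ (+ a₂)) - (+ m) ℤ.* ((+ a₁) - (+ d)) - (+ d)

  lowerBound≡⊖ : ∀ n a₀ a₂ m {c e r a₁ a₁′ d} → c + e ≡ r → a₁ ≡ d + a₁′ →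
    lowerBound r n a₀ a₁ a₂ m d ≡ (c + e) ⊖ (n * a₀ + ((d + m * a₁′) + n * a₂))
  lowerBound≡⊖ n a₀ a₂ m {c} {e} {a₁′ = a₁′} {d} refl refl = begin
    + (c + e) - + n ℤ.* (+ a₀ ℤ.+ + a₂) - + m ℤ.* (+ (d + a₁′) - + d) - + d
      ≡⟨ cong (λ x → + (c + e) - + n ℤ.* (+ a₀ ℤ.+ + a₂) - + m ℤ.* (x - + d) - + d) (ℤ.pos-+ d a₁′) ⟩
    + (c + e) - + n ℤ.* (+ a₀ ℤ.+ + a₂) - + m ℤ.* ((+ d ℤ.+ + a₁′) - + d) - + d
      ≡⟨ solve 7 (λ r n a₀ a₂ m a₁′ d →
           r :- n :* (a₀ :+ a₂) :- m :* ((d :+ a₁′) :- d) :- d := r :- (n :* a₀ :+ ((d :+ m :* a₁′) :+ n :* a₂)))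
           refl (+ (c + e)) (+ n) (+ a₀) (+ a₂) (+ m) (+ a₁′) (+ d) ⟩
    + (c + e) - (+ n ℤ.* + a₀ ℤ.+ ((+ d ℤ.+ + m ℤ.* + a₁′) ℤ.+ + n ℤ.* + a₂))
      ≡⟨ cong (+ (c + e) -_) (sym pos-Y) ⟩
    + (c + e) - + (n * a₀ + ((d + m * a₁′) + n * a₂))
      ≡⟨ ℤ.m-n≡m⊖n (c + e) (n * a₀ + ((d + m * a₁′) + n * a₂)) ⟩
    (c + e) ⊖ (n * a₀ + ((d + m * a₁′) + n * a₂))
      ∎
    where
    open ≡-Reasoning
    pos-Y : + (n * a₀ + ((d + m * a₁′) + n * a₂)) ≡ + n ℤ.* + a₀ ℤ.+ ((+ d ℤ.+ + m ℤ.* + a₁′) ℤ.+ + n ℤ.* + a₂)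
    pos-Y = begin
      + (n * a₀ + ((d + m * a₁′) + n * a₂))
        ≡⟨ ℤ.pos-+ (n * a₀) ((d + m * a₁′) + n * a₂) ⟩
      + (n * a₀) ℤ.+ + ((d + m * a₁′) + n * a₂)
        ≡⟨ cong₂ ℤ._+_ (ℤ.pos-* n a₀) (ℤ.pos-+ (d + m * a₁′) (n * a₂)) ⟩
      + n ℤ.* + a₀ ℤ.+ (+ (d + m * a₁′) ℤ.+ + (n * a₂))
        ≡⟨ cong₂ (λ x y → + n ℤ.* + a₀ ℤ.+ (x ℤ.+ y))
                 (trans (ℤ.pos-+ d (m * a₁′)) (cong (λ x → + d ℤ.+ x) (ℤ.pos-* m a₁′))) (ℤ.pos-* n a₂) ⟩
      + n ℤ.* + a₀ ℤ.+ ((+ d ℤ.+ + m ℤ.* + a₁′) ℤ.+ + n ℤ.* + a₂)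
        ∎

  [m+n]⊖n≡m : ∀ m n → (m + n) ⊖ n ≡ + m
  [m+n]⊖n≡m m n = trans (ℤ.⊖-≥ (m≤n+m n m)) (cong +_ (m+n∸n≡m m n))

  [m+n]⊖o≤m : ∀ m {n o} → n ≤ o → (m + n) ⊖ o ℤ.≤ + m
  [m+n]⊖o≤m m {n} {o} n≤o = ℤ.≤-trans (ℤ.⊖-monoˡ-≤ o (+-monoʳ-≤ m n≤o)) (ℤ.≤-reflexive ([m+n]⊖n≡m m o))

  lowerBound≤ : ∀ n a₀ a₂ m {c e r a₁ a₁′ d} → c + e ≡ r → a₁ ≡ d + a₁′ →
    e ≤ n * a₀ + ((d + m * a₁′) + n * a₂) → lowerBound r n a₀ a₁ a₂ m d ℤ.≤ + c
  lowerBound≤ n a₀ a₂ m {c} {e} c+e≡r a₁≡d+a₁′ e≤Y =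
    ℤ.≤-trans (ℤ.≤-reflexive (lowerBound≡⊖ n a₀ a₂ m {c} {e} c+e≡r a₁≡d+a₁′)) ([m+n]⊖o≤m c e≤Y)

  lowerBound≡ : ∀ n a₀ a₂ m {c e r a₁ a₁′ d} → c + e ≡ r → a₁ ≡ d + a₁′ →
    e ≡ n * a₀ + ((d + m * a₁′) + n * a₂) → + c ≡ lowerBound r n a₀ a₁ a₂ m d
  lowerBound≡ n a₀ a₂ m {c} {e} c+e≡r a₁≡d+a₁′ refl =
    sym (trans (lowerBound≡⊖ n a₀ a₂ m {c} {e} c+e≡r a₁≡d+a₁′) ([m+n]⊖n≡m c e))

import Data.Nat
import Data.Integer
open import Data.Nat using (ℕ; _≥_; _^_; _%_)
open import Data.Nat.Primality using (Prime)
open import Data.Integer using (ℤ; +_; _-_; _≤_)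
open import Data.List using (length)
open import Relation.Binary.PropositionalEquality using (_≡_)
open import Data.Product using (_×_)
open import Data.Nat using (suc; s≤s)
open import Data.Product using (_,_)

lemma4p3 : (k n t m : ℕ) → k ≥ 3 → n ≥ 3 → m % 2 ≡ 1 → n ≡ 2 ^ t Data.Nat.* m →
    let bound = + r2 k n (k Data.Nat.* n)
                - (+ n) Data.Integer.* ((+ length (Nset 0 n k)) Data.Integer.+ (+ length (Nset 2 n k)))
                - (+ m) Data.Integer.* ((+ length (Nset 1 n k)) - (+ δ k))
                - (+ δ k)
    in (bound ≤ + numEdgesNotInNegasym k n)
       × (Prime n → + numEdgesNotInNegasym k n ≡ bound)
lemma4p3 (suc k) (suc n) t m _ (s≤s 2≤n) m-odd n≡2^t*m =
  lowerBound≤ (suc n) N₀ N₂ m (numEdgesNotInNegasym+numEdges-negasymCircuits (suc k) n)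
    (length-N1 k n) (numEdges-negasymCircuits≤ k n t {{odd⇒nonZero m-odd}} n≡2^t*m) ,
  λ n-prime → lowerBound≡ (suc n) N₀ N₂ m (numEdgesNotInNegasym+numEdges-negasymCircuits (suc k) n)
    (length-N1 k n) (numEdges-negasymCircuits-prime k n t 2≤n n≡2^t*m n-prime)
  where
  N₀ N₂ : ℕ
  N₀ = length (Nset 0 (suc n) (suc k))
  N₂ = length (Nset 2 (suc n) (suc k))
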